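{- Let $\Gamma$ be a finite connected unweighted graph in which every vertex has positive degree, and let $\Gamma'$ be an unweighted graph constructed from $\Gamma$ by recursively (finitely many times) attaching pending edges, where attaching a pending edge to a graph means adding one new vertex $i'$ together with one new edge $\{i,i'\}$ joining it to an existing vertex $i$. Then $\mathcal{S}(\Gamma)\le\mathcal{S}(\Gamma')$.
   Context: An unweighted graph has adjacency matrix $(a_{ij})$ with entries in $\{0,1\}$; $\deg(j)=\sum_i a_{ij}$. The surface area of a graph with vertex set $V$ is $\mathcal{S}(\Gamma)=\sum_{j\in V}1/\deg(j)$. -}

module Defs where

open import Data.Nat using (ℕ; zero; suc; _+_; _<_)
open import Data.Fin using (Fin; zero; suc; _≟_)
open import Data.Bool using (Bool; true; false)
open import Data.Integer using (+_)
open import Data.Rational using (ℚ; 0ℚ) renaming (_/_ to _÷_; _+_ to _+ℚ_)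
open import Relation.Nullary using (does)
open import Relation.Binary.PropositionalEquality using (_≡_)

AdjMat : ℕ → Set
AdjMat n = Fin n → Fin n → Bool

Symmetric : ∀ {n} → AdjMat n → Set
Symmetric {n} a = (i j : Fin n) → a i j ≡ a j i

Loopless : ∀ {n} → AdjMat n → Set
Loopless {n} a = (i : Fin n) → a i i ≡ false

sumFin : ∀ {n} → (Fin n → ℕ) → ℕ
sumFin {zero}  f = 0
sumFin {suc n} f = f zero + sumFin (λ i → f (suc i))

sumFinℚ : ∀ {n} → (Fin n → ℚ) → ℚ
sumFinℚ {zero}  f = 0ℚ
sumFinℚ {suc n} f = f zero +ℚ sumFinℚ (λ i → f (suc i))

toℕ𝔹 : Bool → ℕ
toℕ𝔹 true  = 1
toℕ𝔹 false = 0

deg : ∀ {n} → AdjMat n → Fin n → ℕ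
deg a j = sumFin (λ i → toℕ𝔹 (a i j))

-- 1/d (only used when d > 0; the value at 0 is irrelevant under the hypotheses)
inv : ℕ → ℚ
inv zero    = 0ℚ
inv (suc k) = (+ 1) ÷ suc k

surfaceArea : ∀ {n} → AdjMat n → ℚ
surfaceArea a = sumFinℚ (λ j → inv (deg a j))

data Reach {n} (a : AdjMat n) (i : Fin n) : Fin n → Set where
  here : Reach a i i
  step : ∀ {j k} → Reach a i j → a j k ≡ true → Reach a i k

Connected : ∀ {n} → AdjMat n → Set
Connected {n} a = (i j : Fin n) → Reach a i j

-- attaching a pending edge at vertex i: new vertex (index zero) joined only to i
attach : ∀ {n} → AdjMat n → Fin n → AdjMat (suc n)
attach a i zero    zero    = false
attach a i zero    (suc b) = does (b ≟ i)
attach a i (suc c) zero    = does (c ≟ i)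
attach a i (suc c) (suc b) = a c b

data PendantExt {n} (a : AdjMat n) : ∀ {m} → AdjMat m → Set where
  done   : PendantExt a a
  attach-step : ∀ {m} {b : AdjMat m} → PendantExt a b → (i : Fin m) → PendantExt a (attach b i)

{-# OPTIONS --safe #-}
module Submission where

-- Attaching a pending edge at i adds a vertex of degree 1 and raises deg(i) from d to d + 1,
-- so the surface area changes by 1 - 1/d + 1/(d + 1) ≥ 0. Connectedness and positivity of
-- the degrees are not needed (the junk value 1/0 = 0 keeps the bound valid).

open import Defs
open import Data.Nat using (ℕ; zero; suc; _<_; z≤n; s≤s) renaming (_+_ to _+ℕ_)
open import Data.Fin using (Fin; zero; suc; _≟_)
open import Data.Integer using (+≤+)
open import Data.Rational using (0ℚ; 1ℚ; _+_; _≤_; *≤*)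
open import Data.Rational.Properties
  using (≤-refl; ≤-trans; +-mono-≤; +-monoʳ-≤; +-assoc; +-comm; +-identityʳ;
         normalize-nonNeg; nonNegative⁻¹; normalize-coprime; module ≤-Reasoning)
open import Data.Nat.Coprimality using (1-coprimeTo)
open import Relation.Nullary using (does)
open import Relation.Binary.PropositionalEquality using (_≡_; refl; cong)

inv-nonNeg : ∀ d → 0ℚ ≤ inv d
inv-nonNeg zero    = ≤-refl
inv-nonNeg (suc d) = nonNegative⁻¹ _ {{normalize-nonNeg 1 (suc d)}}

inv≤1 : ∀ d → inv d ≤ 1ℚ
inv≤1 zero = *≤* (+≤+ z≤n)
inv≤1 (suc d) rewrite normalize-coprime {1} {d} (1-coprimeTo (suc d)) = *≤* (+≤+ (s≤s z≤n))

inv≤1+inv-suc : ∀ d → inv d ≤ 1ℚ + inv (suc d)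
inv≤1+inv-suc d = begin
  inv d             ≤⟨ inv≤1 d ⟩
  1ℚ                ≡⟨ +-identityʳ 1ℚ ⟨
  1ℚ + 0ℚ           ≤⟨ +-monoʳ-≤ 1ℚ (inv-nonNeg (suc d)) ⟩
  1ℚ + inv (suc d)  ∎
  where open ≤-Reasoning

sumFin-zero : ∀ n → sumFin {n} (λ _ → 0) ≡ 0
sumFin-zero zero    = refl
sumFin-zero (suc n) = sumFin-zero n

sumFin-indicator : ∀ n (i : Fin n) → sumFin (λ j → toℕ𝔹 (does (j ≟ i))) ≡ 1
sumFin-indicator (suc n) zero    = cong suc (sumFin-zero n)
sumFin-indicator (suc n) (suc i) = sumFin-indicator n i

deg-attach-new : ∀ {n} (a : AdjMat n) (i : Fin n) → deg (attach a i) zero ≡ 1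
deg-attach-new {n} a i = sumFin-indicator n i

sumFinℚ-inv-increment : ∀ n (i : Fin n) (f : Fin n → ℕ) →
  sumFinℚ (λ j → inv (f j)) ≤ 1ℚ + sumFinℚ (λ j → inv (toℕ𝔹 (does (j ≟ i)) +ℕ f j))
sumFinℚ-inv-increment (suc n) zero f = begin
  inv (f zero) + rest               ≤⟨ +-mono-≤ (inv≤1+inv-suc (f zero)) ≤-refl ⟩
  (1ℚ + inv (suc (f zero))) + rest  ≡⟨ +-assoc 1ℚ (inv (suc (f zero))) rest ⟩
  1ℚ + (inv (suc (f zero)) + rest)  ∎
  where
    open ≤-Reasoning
    rest = sumFinℚ (λ j → inv (f (suc j)))
sumFinℚ-inv-increment (suc n) (suc i) f = begin
  x + sumFinℚ (λ j → inv (f (suc j)))  ≤⟨ +-monoʳ-≤ x (sumFinℚ-inv-increment n i (λ j → f (suc j))) ⟩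
  x + (1ℚ + rest)                      ≡⟨ +-assoc x 1ℚ rest ⟨
  (x + 1ℚ) + rest                      ≡⟨ cong (_+ rest) (+-comm x 1ℚ) ⟩
  (1ℚ + x) + rest                      ≡⟨ +-assoc 1ℚ x rest ⟩
  1ℚ + (x + rest)                      ∎
  where
    open ≤-Reasoning
    x    = inv (f zero)
    rest = sumFinℚ (λ j → inv (toℕ𝔹 (does (j ≟ i)) +ℕ f (suc j)))

surfaceArea-attach : ∀ {n} (a : AdjMat n) (i : Fin n) → surfaceArea a ≤ surfaceArea (attach a i)
surfaceArea-attach {n} a i rewrite deg-attach-new a i = sumFinℚ-inv-increment n i (deg a)

surfaceArea-mono-PendantExt : ∀ {n m} {a : AdjMat n} {b : AdjMat m} →
  PendantExt a b → surfaceArea a ≤ surfaceArea b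
surfaceArea-mono-PendantExt done                = ≤-refl
surfaceArea-mono-PendantExt (attach-step ext i) =
  ≤-trans (surfaceArea-mono-PendantExt ext) (surfaceArea-attach _ i)

mainTheorem6 : (n : ℕ) (Γ : AdjMat n) → Symmetric Γ → Loopless Γ → Connected Γ →
    ((j : Fin n) → 0 < deg Γ j) →
    (m : ℕ) (Γ' : AdjMat m) → PendantExt Γ Γ' →
    surfaceArea Γ ≤ surfaceArea Γ'
mainTheorem6 _ _ _ _ _ _ _ _ ext = surfaceArea-mono-PendantExt ext
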